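{- Let $G=\langle V,E,r\rangle$ be a trimmed and flat rooted directed graph with $n=n(G)$ nodes and $m=m(G)$ edges that admits fewer than $m^4$ arborescences. Let $A,B$ be two edge-disjoint arborescences of $G$ such that for every edge $(u,v)\in E$, $v$ is not an ancestor of $u$ in at least one of $A,B$, and let $C=E\setminus(A\cup B)$. Then there are $\mathcal{O}(\log n)$ nodes $v$ such that some edge $(u,v)$ belongs to $C$.
   Context: Parallel edges allowed, no loops. An arborescence is a set of $n-1$ edges such that every node is reachable from $r$ using only them, viewed as a tree rooted at $r$. An edge is nontrivial if it is in some but not all arborescences; trimmed means every edge is nontrivial; flat means at most two parallel copies of each edge. -}

module Defs where

open import Data.Nat using (ℕ; zero; suc; _+_; _*_; _∸_; _^_; _≤_; _<_)
open import Data.Nat.Logarithm using (⌊log₂_⌋)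
open import Data.Fin using (Fin)
open import Data.Fin.Subset using (Subset; _∈_; _∉_; ∣_∣)
open import Data.List using (List; length)
open import Data.List.Relation.Unary.All using (All)
open import Data.List.Relation.Unary.Unique.Propositional using (Unique)
open import Data.Product using (Σ; ∃; ∃-syntax; _×_; _,_)
open import Relation.Binary.PropositionalEquality using (_≡_; _≢_)
open import Relation.Nullary using (¬_)
open import Data.Sum using (_⊎_)
open import Data.Empty using (⊥)

record RootedGraph : Set where
  field
    n    : ℕ
    m    : ℕ
    root : Fin n
    src  : Fin m → Fin n
    tgt  : Fin m → Fin n
    noLoop : ∀ e → src e ≢ tgt e

module _ (G : RootedGraph) where
  open RootedGraph G

  data ReachFrom (S : Subset m) (x : Fin n) : Fin n → Set where
    here : ReachFrom S x x
    step : ∀ {u} (e : Fin m) → ReachFrom S x u → e ∈ S → src e ≡ u →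
           ReachFrom S x (tgt e)

  IsArborescence : Subset m → Set
  IsArborescence S = (∣ S ∣ ≡ n ∸ 1) × (∀ v → ReachFrom S root v)

  Ancestor : Subset m → Fin n → Fin n → Set
  Ancestor A v u = ReachFrom A v u

  Nontrivial : Fin m → Set
  Nontrivial e = (∃[ S ] (IsArborescence S × e ∈ S))
               × (∃[ S ] (IsArborescence S × e ∉ S))

  Trimmed : Set
  Trimmed = ∀ e → Nontrivial e

  -- at most two parallel copies of each edge
  Flat : Set
  Flat = ∀ (e₁ e₂ e₃ : Fin m) → e₁ ≢ e₂ → e₁ ≢ e₃ → e₂ ≢ e₃ →
         src e₁ ≡ src e₂ → tgt e₁ ≡ tgt e₂ →
         src e₁ ≡ src e₃ → tgt e₁ ≡ tgt e₃ → ⊥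

  FewerArborescencesThan : ℕ → Set
  FewerArborescencesThan k =
    ∀ (L : List (Subset m)) → Unique L → All IsArborescence L → length L < k

  EdgeDisjoint : Subset m → Subset m → Set
  EdgeDisjoint A B = ∀ e → e ∈ A → e ∉ B

  AncestorCondition : Subset m → Subset m → Set
  AncestorCondition A B = ∀ e → ¬ Ancestor A (tgt e) (src e) ⊎ ¬ Ancestor B (tgt e) (src e)

  HeadOfC : Subset m → Subset m → Fin n → Set
  HeadOfC A B v = ∃[ e ] (e ∉ A × e ∉ B × tgt e ≡ v)

{-# OPTIONS --safe #-}
-- For v ∈ T let ê v = (u, v) be an edge of C. By the ancestor condition v is not an ancestor
-- of u in one of the trees X ∈ {A, B}, so the root path of v in X is not a prefix of that of
-- u, and comparing root paths lexicographically (edges by index, or by reversed index) puts u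
-- before v in one of two orders. Counting predecessors turns each order into a rank that
-- increases along every tree edge, so T is covered by four sets K of nodes whose edge ê v
-- increases the rank of a fixed tree and order. For J ⊆ K, trading the tree edge entering v
-- for ê v at every v ∈ J keeps all in-degrees and lets every node be reached from the root by
-- descending rank, so it gives an arborescence, and distinct J give distinct ones. Hence
-- 2 ^ ∣K∣ < m ^ 4 ≤ (2 n²) ^ 4 for flat G, so ∣K∣ ≤ 12 (⌊log₂ n⌋ + 1) and ∣T∣ ≤ 48 (⌊log₂ n⌋ + 1).
module Submission where

open import Defs
open import Level using (Level)
open import Data.Bool using (Bool; if_then_else_)
open import Data.Empty using (⊥)
open import Data.Nat using (ℕ; zero; suc; _+_; _*_; _∸_; _^_; _≤_; _<_; z≤n; s≤s; z<s)
open import Data.Nat.Properties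
  using ( ≤-refl; ≤-reflexive; ≤-trans; ≤-antisym; <⇒≤; <⇒≱; ≰⇒>; <-≤-trans; m≤n⇒m<n∨m≡n
        ; m≤m+n; m+1+n≰m; +-suc; +-identityʳ; +-mono-≤; +-monoʳ-≤; +-mono-<-≤; +-mono-≤-<
        ; *-distribʳ-+; *-monoˡ-≤; *-mono-≤; ^-monoˡ-≤; ^-monoʳ-≤; ^-distribˡ-+-*; ^-*-assoc
        ; _<?_; +-0-commutativeMonoid; module ≤-Reasoning )
open import Data.Nat.Induction using (<-wellFounded)
open import Data.Nat.Logarithm using (⌊log₂_⌋; ⌊log₂⌋-mono-≤; ⌊log₂[2^n]⌋≡n)
open import Data.Nat.Tactic.RingSolver using (solve-∀)
open import Data.Fin using (Fin; zero; suc; combine) renaming (_<_ to _<ᶠ_)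
open import Data.Fin.Properties
  using (_≟_; any?; <-cmp; <⇒≢; combine-injective; injective⇒≤; <-isStrictTotalOrder)
  renaming (_<?_ to _<ᶠ?_; <-trans to <ᶠ-trans)
open import Data.Fin.Subset using (Subset; inside; outside; _∈_; _∉_; _⊆_; _∪_; ∁; ⁅_⁆; ∣_∣)
open import Data.Fin.Subset.Properties
  using ( _∈?_; x∈⁅x⁆; x∈⁅y⁆⇒x≡y; x∈∁p⇒x∉p; x∉p⇒x∈∁p; x∈p∪q⁺; ⊆-antisym
        ; ∣∁p∣≡n∸∣p∣; ∣⁅x⁆∣≡1; ∣p∣≤∣x∷p∣; p⊆q⇒∣p∣≤∣q∣ )
open import Data.Vec using ([]; _∷_; tabulate; here; there)
open import Data.Vec.Properties using (lookup∘tabulate; lookup⇒[]=; []=⇒lookup; ∷-injectiveʳ)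
open import Data.List using (List; []; _∷_; _∷ʳ_; _++_; map; length)
open import Data.List.Properties using (length-map; length-++; ∷ʳ-injectiveʳ; ++-conicalʳ)
open import Data.List.Membership.Propositional using () renaming (_∈_ to _∈ₗ_)
open import Data.List.Membership.Propositional.Properties using (∈-map⁻)
open import Data.List.Relation.Unary.All using (All; []; _∷_)
import Data.List.Relation.Unary.All as All
import Data.List.Relation.Unary.All.Properties as All
open import Data.List.Relation.Unary.AllPairs using ([]; _∷_)
open import Data.List.Relation.Unary.Unique.Propositional using (Unique)
import Data.List.Relation.Unary.Unique.Propositional.Properties as Unique
open import Data.List.Relation.Binary.Prefix.Heterogeneous using (Prefix; []; _∷_)
open import Data.List.Relation.Binary.Lex.Strict
  using (Lex-<; halt; this; next; <-transitive; <-irreflexive; <-decidable)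
import Data.List.Relation.Binary.Pointwise as Pointwise
open import Data.Product using (∃-syntax; _×_; _,_; proj₁; proj₂)
open import Data.Sum using (_⊎_; inj₁; inj₂)
import Data.Sum as Sum
open import Function using (_∘_; flip)
open import Induction.WellFounded using (Acc; acc)
open import Relation.Nullary using (¬_; Dec; yes; no; does; ¬?; _×-dec_; _⊎-dec_; contradiction)
open import Relation.Nullary.Decidable using (dec-true; dec-false)
open import Relation.Unary using (Pred; Decidable)
open import Relation.Binary
  using (Rel; Transitive; Trichotomous; IsStrictTotalOrder; tri<; tri≈; tri>)
  renaming (Decidable to Decidable₂)
import Relation.Binary.Construct.Flip.EqAndOrd as Flip
open import Relation.Binary.PropositionalEquality
open import Algebra.Properties.CommutativeMonoid.Sum +-0-commutativeMonoid
  using (sum; sum-syntax; ∑-comm; ∑-distrib-+; sum-cong-≗; sum-replicate-zero)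

private variable
  ℓ : Level
  k : ℕ

∑-mono-≤ : ∀ {k} {f g : Fin k → ℕ} → (∀ i → f i ≤ g i) → sum f ≤ sum g
∑-mono-≤ {zero}  f≤g = z≤n
∑-mono-≤ {suc k} f≤g = +-mono-≤ (f≤g zero) (∑-mono-≤ (f≤g ∘ suc))

∑-mono-< : ∀ {k} {f g : Fin k → ℕ} → (∀ i → f i ≤ g i) → ∀ j → f j < g j → sum f < sum g
∑-mono-< f≤g zero    fj<gj = +-mono-<-≤ fj<gj (∑-mono-≤ (f≤g ∘ suc))
∑-mono-< f≤g (suc j) fj<gj = +-mono-≤-< (f≤g zero) (∑-mono-< (f≤g ∘ suc) j fj<gj)

∑-mono-≤-tight : ∀ {k} {f g : Fin k → ℕ} →
                 (∀ i → f i ≤ g i) → sum g ≤ sum f → ∀ i → f i ≡ g i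
∑-mono-≤-tight f≤g ∑g≤∑f i with m≤n⇒m<n∨m≡n (f≤g i)
... | inj₁ fi<gi = contradiction ∑g≤∑f (<⇒≱ (∑-mono-< f≤g i fi<gi))
... | inj₂ fi≡gi = fi≡gi

𝟙 : ∀ {p} {P : Set p} → Dec P → ℕ
𝟙 P? = if does P? then 1 else 0

module _ {p} {P : Set p} where

  𝟙-yes : (P? : Dec P) → P → 𝟙 P? ≡ 1
  𝟙-yes P? p = cong (λ b → if b then 1 else 0) (dec-true P? p)

  𝟙-no : (P? : Dec P) → ¬ P → 𝟙 P? ≡ 0
  𝟙-no P? ¬p = cong (λ b → if b then 1 else 0) (dec-false P? ¬p)

  𝟙≤1 : (P? : Dec P) → 𝟙 P? ≤ 1
  𝟙≤1 (yes _) = ≤-refl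
  𝟙≤1 (no _)  = z≤n

  𝟙-mono : ∀ {q} {Q : Set q} (P? : Dec P) (Q? : Dec Q) → (P → Q) → 𝟙 P? ≤ 𝟙 Q?
  𝟙-mono (yes p) (yes _) _   = ≤-refl
  𝟙-mono (yes p) (no ¬q) P⇒Q = contradiction (P⇒Q p) ¬q
  𝟙-mono (no _)  _       _   = z≤n

count : {P : Pred (Fin k) ℓ} → Decidable P → ℕ
count {k} P? = ∑[ i < k ] 𝟙 (P? i)

module _ {ℓ′} {P : Pred (Fin k) ℓ} {Q : Pred (Fin k) ℓ′} (P? : Decidable P) (Q? : Decidable Q) where

  count-mono : (∀ {i} → P i → Q i) → count P? ≤ count Q?
  count-mono P⇒Q = ∑-mono-≤ (λ i → 𝟙-mono (P? i) (Q? i) P⇒Q)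

  count-cong : (∀ {i} → P i → Q i) → (∀ {i} → Q i → P i) → count P? ≡ count Q?
  count-cong P⇒Q Q⇒P = ≤-antisym (count-mono P⇒Q) (∑-mono-≤ (λ i → 𝟙-mono (Q? i) (P? i) Q⇒P))

∣p∣≡count : (p : Subset k) → ∣ p ∣ ≡ count (_∈? p)
∣p∣≡count []            = refl
∣p∣≡count (inside  ∷ p) = cong suc (∣p∣≡count p)
∣p∣≡count (outside ∷ p) = ∣p∣≡count p

count-≡ : (a : Fin k) → count (_≟ a) ≡ 1
count-≡ a = begin
  count (_≟ a)       ≡⟨ count-cong (_≟ a) (_∈? ⁅ a ⁆) (λ { refl → x∈⁅x⁆ a }) (x∈⁅y⁆⇒x≡y a) ⟩
  count (_∈? ⁅ a ⁆)  ≡⟨ ∣p∣≡count ⁅ a ⁆ ⟨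
  ∣ ⁅ a ⁆ ∣          ≡⟨ ∣⁅x⁆∣≡1 a ⟩
  1                  ∎
  where open ≡-Reasoning

count-≢ : (a : Fin k) → count (λ i → ¬? (i ≟ a)) ≡ k ∸ 1
count-≢ {k} a = begin
  count (λ i → ¬? (i ≟ a))  ≡⟨ count-cong (λ i → ¬? (i ≟ a)) (_∈? ∁ ⁅ a ⁆) ≢⇒∈∁ ∈∁⇒≢ ⟩
  count (_∈? ∁ ⁅ a ⁆)       ≡⟨ ∣p∣≡count (∁ ⁅ a ⁆) ⟨
  ∣ ∁ ⁅ a ⁆ ∣               ≡⟨ ∣∁p∣≡n∸∣p∣ ⁅ a ⁆ ⟩
  k ∸ ∣ ⁅ a ⁆ ∣             ≡⟨ cong (k ∸_) (∣⁅x⁆∣≡1 a) ⟩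
  k ∸ 1                     ∎
  where
  open ≡-Reasoning
  ≢⇒∈∁ : ∀ {i} → i ≢ a → i ∈ ∁ ⁅ a ⁆
  ≢⇒∈∁ i≢a = x∉p⇒x∈∁p (i≢a ∘ x∈⁅y⁆⇒x≡y a)
  ∈∁⇒≢ : ∀ {i} → i ∈ ∁ ⁅ a ⁆ → i ≢ a
  ∈∁⇒≢ i∈∁a refl = x∈∁p⇒x∉p i∈∁a (x∈⁅x⁆ a)

module _ {P : Pred (Fin k) ℓ} (P? : Decidable P) where

  1≤count : ∀ {a} → P a → 1 ≤ count P?
  1≤count {a} Pa = subst (_≤ count P?) (count-≡ a) (count-mono (_≟ a) P? (λ { refl → Pa }))

  2≤count : ∀ {a b} → P a → P b → a ≢ b → 2 ≤ count P?
  2≤count {a} {b} Pa Pb a≢b = begin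
    2                                        ≡⟨ cong₂ _+_ (count-≡ a) (count-≡ b) ⟨
    count (_≟ a) + count (_≟ b)              ≡⟨ ∑-distrib-+ (𝟙 ∘ (_≟ a)) (𝟙 ∘ (_≟ b)) ⟨
    ∑[ i < k ] (𝟙 (i ≟ a) + 𝟙 (i ≟ b))       ≤⟨ ∑-mono-≤ at-most-one-of-a-b ⟩
    count P?                                 ∎
    where
    open ≤-Reasoning
    at-most-one-of-a-b : ∀ i → 𝟙 (i ≟ a) + 𝟙 (i ≟ b) ≤ 𝟙 (P? i)
    at-most-one-of-a-b i with i ≟ a | i ≟ b | P? i
    ... | yes refl | yes refl | _     = contradiction refl a≢b
    ... | yes refl | no _     | yes _ = ≤-refl
    ... | yes refl | no _     | no ¬P = contradiction Pa ¬P
    ... | no _     | yes refl | yes _ = ≤-refl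
    ... | no _     | yes refl | no ¬P = contradiction Pb ¬P
    ... | no _     | no _     | _     = z≤n

  count-fibres : ∀ {m} (f : Fin k → Fin m) →
                 count P? ≡ ∑[ j < m ] count (λ i → P? i ×-dec f i ≟ j)
  count-fibres {m} f = begin
    ∑[ i < k ] 𝟙 (P? i)                            ≡⟨ sum-cong-≗ fibre-sizes ⟨
    ∑[ i < k ] ∑[ j < m ] 𝟙 (P? i ×-dec f i ≟ j)   ≡⟨ ∑-comm (λ i j → 𝟙 (P? i ×-dec f i ≟ j)) ⟩
    ∑[ j < m ] ∑[ i < k ] 𝟙 (P? i ×-dec f i ≟ j)   ∎
    where
    open ≡-Reasoning
    fibre-sizes : ∀ i → ∑[ j < m ] 𝟙 (P? i ×-dec f i ≟ j) ≡ 𝟙 (P? i)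
    fibre-sizes i = fibre-size (P? i)
      where
      fibre-size : (Pi? : Dec (P i)) → ∑[ j < m ] 𝟙 (Pi? ×-dec f i ≟ j) ≡ 𝟙 Pi?
      fibre-size Pi?@(yes Pi) = trans
        (count-cong (λ j → Pi? ×-dec f i ≟ j) (_≟ f i) (sym ∘ proj₂) (λ { refl → Pi , refl }))
        (count-≡ (f i))
      fibre-size (no _) = sum-replicate-zero m

∣p∪q∣≤∣p∣+∣q∣ : (p q : Subset k) → ∣ p ∪ q ∣ ≤ ∣ p ∣ + ∣ q ∣
∣p∪q∣≤∣p∣+∣q∣ []            []            = z≤n
∣p∪q∣≤∣p∣+∣q∣ (outside ∷ p) (outside ∷ q) = ∣p∪q∣≤∣p∣+∣q∣ p q
∣p∪q∣≤∣p∣+∣q∣ (inside  ∷ p) (x       ∷ q) =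
  s≤s (≤-trans (∣p∪q∣≤∣p∣+∣q∣ p q) (+-monoʳ-≤ ∣ p ∣ (∣p∣≤∣x∷p∣ x q)))
∣p∪q∣≤∣p∣+∣q∣ (outside ∷ p) (inside  ∷ q) =
  ≤-trans (s≤s (∣p∪q∣≤∣p∣+∣q∣ p q)) (≤-reflexive (sym (+-suc ∣ p ∣ ∣ q ∣)))

⟦_⟧ : {P : Pred (Fin k) ℓ} → Decidable P → Subset k
⟦ P? ⟧ = tabulate (does ∘ P?)

module _ {P : Pred (Fin k) ℓ} (P? : Decidable P) where

  ∈⟦⟧⁺ : ∀ {i} → P i → i ∈ ⟦ P? ⟧
  ∈⟦⟧⁺ {i} Pi = lookup⇒[]= i ⟦ P? ⟧ (trans (lookup∘tabulate (does ∘ P?) i) (dec-true (P? i) Pi))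

  ∈⟦⟧⁻ : ∀ {i} → i ∈ ⟦ P? ⟧ → P i
  ∈⟦⟧⁻ {i} i∈P with P? i | trans (sym (lookup∘tabulate (does ∘ P?) i)) ([]=⇒lookup i∈P)
  ... | yes Pi | _  = Pi
  ... | no _   | ()

subsetsOf : Subset k → List (Subset k)
subsetsOf []            = [] ∷ []
subsetsOf (outside ∷ p) = map (outside ∷_) (subsetsOf p)
subsetsOf (inside  ∷ p) = map (outside ∷_) (subsetsOf p) ++ map (inside ∷_) (subsetsOf p)

length-subsetsOf : (p : Subset k) → length (subsetsOf p) ≡ 2 ^ ∣ p ∣
length-subsetsOf []            = refl
length-subsetsOf (outside ∷ p) = trans (length-map (outside ∷_) (subsetsOf p)) (length-subsetsOf p)
length-subsetsOf (inside  ∷ p) = begin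
  length (map (outside ∷_) (subsetsOf p) ++ map (inside ∷_) (subsetsOf p))
    ≡⟨ length-++ (map (outside ∷_) (subsetsOf p)) ⟩
  length (map (outside ∷_) (subsetsOf p)) + length (map (inside ∷_) (subsetsOf p))
    ≡⟨ cong₂ _+_ (length-map (outside ∷_) (subsetsOf p)) (length-map (inside ∷_) (subsetsOf p)) ⟩
  length (subsetsOf p) + length (subsetsOf p)
    ≡⟨ cong (λ l → l + l) (length-subsetsOf p) ⟩
  2 ^ ∣ p ∣ + 2 ^ ∣ p ∣
    ≡⟨ cong (2 ^ ∣ p ∣ +_) (+-identityʳ (2 ^ ∣ p ∣)) ⟨
  2 ^ suc ∣ p ∣
    ∎
  where open ≡-Reasoning

subsetsOf-unique : (p : Subset k) → Unique (subsetsOf p)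
subsetsOf-unique []            = [] ∷ []
subsetsOf-unique (outside ∷ p) = Unique.map⁺ ∷-injectiveʳ (subsetsOf-unique p)
subsetsOf-unique {suc k} (inside ∷ p) =
  Unique.++⁺ (unique-with outside) (unique-with inside) heads-differ
  where
  with-head : Bool → List (Subset (suc k))
  with-head x = map (x ∷_) (subsetsOf p)
  unique-with : ∀ x → Unique (with-head x)
  unique-with x = Unique.map⁺ ∷-injectiveʳ (subsetsOf-unique p)
  heads-differ : ∀ {q} → q ∈ₗ with-head outside × q ∈ₗ with-head inside → ⊥
  heads-differ (q∈outside , q∈inside) with ∈-map⁻ (outside ∷_) q∈outside | ∈-map⁻ (inside ∷_) q∈inside
  ... | _ , _ , refl | _ , _ , ()

subsetsOf-⊆ : (p : Subset k) → All (_⊆ p) (subsetsOf p)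
subsetsOf-⊆ []            = (λ ()) ∷ []
subsetsOf-⊆ (outside ∷ p) = All.map⁺ (All.map outside∷-⊆ (subsetsOf-⊆ p))
  where
  outside∷-⊆ : ∀ {q} → q ⊆ p → outside ∷ q ⊆ outside ∷ p
  outside∷-⊆ q⊆p (there i∈q) = there (q⊆p i∈q)
subsetsOf-⊆ (inside  ∷ p) =
  All.++⁺ (All.map⁺ (All.map outside∷-⊆ (subsetsOf-⊆ p)))
          (All.map⁺ (All.map inside∷-⊆ (subsetsOf-⊆ p)))
  where
  outside∷-⊆ : ∀ {q} → q ⊆ p → outside ∷ q ⊆ inside ∷ p
  outside∷-⊆ q⊆p (there i∈q) = there (q⊆p i∈q)
  inside∷-⊆ : ∀ {q} → q ⊆ p → inside ∷ q ⊆ inside ∷ p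
  inside∷-⊆ q⊆p here        = here
  inside∷-⊆ q⊆p (there i∈q) = there (q⊆p i∈q)

Unique-map⁺-on : ∀ {a b p} {A : Set a} {B : Set b} {P : Pred A p} {xs} (f : A → B) →
                 (∀ {x y} → P x → P y → f x ≡ f y → x ≡ y) →
                 All P xs → Unique xs → Unique (map f xs)
Unique-map⁺-on f inj []         []           = []
Unique-map⁺-on f inj (Px ∷ Pxs) (x∉xs ∷ xs!) =
  All.map⁺ (All.map (λ (Py , x≢y) → x≢y ∘ inj Px Py) (All.zip (Pxs , x∉xs)))
  ∷ Unique-map⁺-on f inj Pxs xs!

module Rank {_⊏_ : Rel (Fin k) ℓ} (⊏-trans : Transitive _⊏_) (⊏-irrefl : ∀ {x} → ¬ x ⊏ x)
            (_⊏?_ : Decidable₂ _⊏_) where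

  rank : Fin k → ℕ
  rank x = count (_⊏? x)

  rank-mono : ∀ {x y} → x ⊏ y → rank x < rank y
  rank-mono {x} {y} x⊏y = ∑-mono-< (λ w → 𝟙-mono (w ⊏? x) (w ⊏? y) (λ w⊏x → ⊏-trans w⊏x x⊏y)) x
    (subst₂ _<_ (sym (𝟙-no (x ⊏? x) ⊏-irrefl)) (sym (𝟙-yes (x ⊏? y) x⊏y)) z<s)

module _ {a} {A : Set a} where

  Prefix-[]⁻ : ∀ {xs : List A} → Prefix _≡_ xs [] → xs ≡ []
  Prefix-[]⁻ [] = refl

  Prefix-∷ʳ⁻ : ∀ {xs} ys (y : A) → Prefix _≡_ xs (ys ∷ʳ y) → xs ≡ ys ∷ʳ y ⊎ Prefix _≡_ xs ys
  Prefix-∷ʳ⁻ []       y []           = inj₂ []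
  Prefix-∷ʳ⁻ []       y (refl ∷ [])  = inj₁ refl
  Prefix-∷ʳ⁻ (z ∷ ys) y []           = inj₂ []
  Prefix-∷ʳ⁻ (z ∷ ys) y (refl ∷ xs⊑) = Sum.map (cong (z ∷_)) (refl ∷_) (Prefix-∷ʳ⁻ ys y xs⊑)

module _ {a ℓ} {A : Set a} {_≺_ : Rel A ℓ} where

  Lex-<-∷ʳ : ∀ xs {x} → Lex-< _≡_ _≺_ xs (xs ∷ʳ x)
  Lex-<-∷ʳ []       = halt
  Lex-<-∷ʳ (y ∷ xs) = next refl (Lex-<-∷ʳ xs)

  Lex-<-dichotomy : Trichotomous _≡_ _≺_ → ∀ xs ys → ¬ Prefix _≡_ ys xs →
                    Lex-< _≡_ _≺_ xs ys ⊎ Lex-< _≡_ (flip _≺_) xs ys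
  Lex-<-dichotomy compare []       []       ys⋢xs = contradiction [] ys⋢xs
  Lex-<-dichotomy compare []       (y ∷ ys) ys⋢xs = inj₁ halt
  Lex-<-dichotomy compare (x ∷ xs) []       ys⋢xs = contradiction [] ys⋢xs
  Lex-<-dichotomy compare (x ∷ xs) (y ∷ ys) ys⋢xs with compare x y
  ... | tri< x≺y _ _  = inj₁ (this x≺y)
  ... | tri> _ _ y≺x  = inj₂ (this y≺x)
  ... | tri≈ _ refl _ =
    Sum.map (next refl) (next refl) (Lex-<-dichotomy compare xs ys (ys⋢xs ∘ (refl ∷_)))

module _ (G : RootedGraph) where
  open RootedGraph G

  InEdge : Subset m → Fin n → Fin m → Set
  InEdge S v e = e ∈ S × tgt e ≡ v

  inEdge? : ∀ S v e → Dec (InEdge S v e)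
  inEdge? S v e = e ∈? S ×-dec tgt e ≟ v

  inDegree : Subset m → Fin n → ℕ
  inDegree S v = count (inEdge? S v)

  ∣S∣≡∑inDegree : ∀ S → ∣ S ∣ ≡ ∑[ v < n ] inDegree S v
  ∣S∣≡∑inDegree S = trans (∣p∣≡count S) (count-fibres (_∈? S) tgt)

  in-edge : ∀ {S v} → ReachFrom G S root v → v ≢ root → ∃[ e ] InEdge S v e
  in-edge here                v≢root = contradiction refl v≢root
  in-edge (step e _ e∈S refl) _      = e , e∈S , refl

  descent⇒reachable : ∀ {S} (ρ : Fin n → ℕ) →
                      (∀ {v} → v ≢ root → ∃[ e ] (InEdge S v e × ρ (src e) < ρ v)) →
                      ∀ v → ReachFrom G S root v
  descent⇒reachable {S} ρ descent v = reach v (<-wellFounded (ρ v))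
    where
    reach : ∀ v → Acc _<_ (ρ v) → ReachFrom G S root v
    reach v (acc smaller) with v ≟ root
    ... | yes refl = here
    ... | no v≢root with descent v≢root
    ...   | e , (e∈S , refl) , ρ< = step e (reach (src e) (smaller ρ<)) e∈S refl

  edges : ∀ {S x v} → ReachFrom G S x v → List (Fin m)
  edges here           = []
  edges (step e π _ _) = edges π ∷ʳ e

  edges≡[] : ∀ {S x v} (π : ReachFrom G S x v) → edges π ≡ [] → v ≡ x
  edges≡[] here           _  = refl
  edges≡[] (step e π _ _) eq with () ← ++-conicalʳ (edges π) (e ∷ []) eq

  edges≡∷ʳ : ∀ {S x v es e} (π : ReachFrom G S x v) → edges π ≡ es ∷ʳ e → v ≡ tgt e
  edges≡∷ʳ {es = es} {e} here           eq with () ← ++-conicalʳ es (e ∷ []) (sym eq)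
  edges≡∷ʳ {es = es}     (step e π _ _) eq = cong tgt (∷ʳ-injectiveʳ (edges π) es eq)

module Arborescence (G : RootedGraph) {X : Subset (RootedGraph.m G)} (X-arb : IsArborescence G X)
  where
  open RootedGraph G

  reach : ∀ v → ReachFrom G X root v
  reach = proj₂ X-arb

  inDegree≡𝟙[≢root] : ∀ v → inDegree G X v ≡ 𝟙 (¬? (v ≟ root))
  inDegree≡𝟙[≢root] v = sym (∑-mono-≤-tight at-least-one (≤-reflexive ∑-equal) v)
    where
    at-least-one : ∀ v → 𝟙 (¬? (v ≟ root)) ≤ inDegree G X v
    at-least-one v with v ≟ root
    ... | yes _     = z≤n
    ... | no v≢root = 1≤count (inEdge? G X v) (proj₂ (in-edge G (reach v) v≢root))
    ∑-equal : ∑[ v < n ] inDegree G X v ≡ ∑[ v < n ] 𝟙 (¬? (v ≟ root))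
    ∑-equal = trans (sym (∣S∣≡∑inDegree G X)) (trans (proj₁ X-arb) (sym (count-≢ root)))

  inDegree-nonRoot : ∀ {v} → v ≢ root → inDegree G X v ≡ 1
  inDegree-nonRoot {v} v≢root = trans (inDegree≡𝟙[≢root] v) (𝟙-yes (¬? (v ≟ root)) v≢root)

  no-in-edge-at-root : ∀ {e} → e ∈ X → tgt e ≢ root
  no-in-edge-at-root {e} e∈X tgt≡root = contradiction one≤zero λ ()
    where
    one≤zero : 1 ≤ 0
    one≤zero = begin
      1                     ≤⟨ 1≤count (inEdge? G X root) (e∈X , tgt≡root) ⟩
      inDegree G X root     ≡⟨ inDegree≡𝟙[≢root] root ⟩
      𝟙 (¬? (root ≟ root))  ≡⟨ 𝟙-no (¬? (root ≟ root)) (λ root≢root → root≢root refl) ⟩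
      0                     ∎
      where open ≤-Reasoning

  in-edge-unique : ∀ {e e′} → e ∈ X → e′ ∈ X → tgt e ≡ tgt e′ → e ≡ e′
  in-edge-unique {e} {e′} e∈X e′∈X tgt≡ with e ≟ e′
  ... | yes e≡e′ = e≡e′
  ... | no e≢e′  = contradiction two≤one λ { (s≤s ()) }
    where
    two≤one : 2 ≤ 1
    two≤one = begin
      2                      ≤⟨ 2≤count (inEdge? G X (tgt e)) (e∈X , refl) (e′∈X , sym tgt≡) e≢e′ ⟩
      inDegree G X (tgt e)   ≡⟨ inDegree≡𝟙[≢root] (tgt e) ⟩
      𝟙 (¬? (tgt e ≟ root))  ≤⟨ 𝟙≤1 (¬? (tgt e ≟ root)) ⟩
      1                      ∎
      where open ≤-Reasoning

  edges-unique : ∀ {v v′} (π : ReachFrom G X root v) (π′ : ReachFrom G X root v′) →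
                 v ≡ v′ → edges G π ≡ edges G π′
  edges-unique here             here               _  = refl
  edges-unique here             (step _ _ e′∈X _) eq = contradiction (sym eq) (no-in-edge-at-root e′∈X)
  edges-unique (step _ _ e∈X _) here               eq = contradiction eq (no-in-edge-at-root e∈X)
  edges-unique (step e π e∈X refl) (step e′ π′ e′∈X refl) eq with in-edge-unique e∈X e′∈X eq
  ... | refl = cong (_∷ʳ e) (edges-unique π π′ refl)

  path : Fin n → List (Fin m)
  path v = edges G (reach v)

  path-∷ʳ : ∀ {e} → e ∈ X → path (tgt e) ≡ path (src e) ∷ʳ e
  path-∷ʳ {e} e∈X = edges-unique (reach (tgt e)) (step e (reach (src e)) e∈X refl) refl

  prefix⇒ancestor : ∀ {u} v (π : ReachFrom G X root u) →
                    Prefix _≡_ (path v) (edges G π) → Ancestor G X v u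
  prefix⇒ancestor v here v⊑[] =
    subst (λ w → Ancestor G X w root) (sym (edges≡[] G (reach v) (Prefix-[]⁻ v⊑[]))) here
  prefix⇒ancestor v (step e π e∈X src≡) v⊑π with Prefix-∷ʳ⁻ (edges G π) e v⊑π
  ... | inj₁ path≡ = subst (λ w → Ancestor G X w (tgt e)) (sym (edges≡∷ʳ G (reach v) path≡)) here
  ... | inj₂ v⊑π′  = step e (prefix⇒ancestor v π v⊑π′) e∈X src≡

  ¬ancestor⇒path-ordered : ∀ {ℓ} {_≺_ : Rel (Fin m) ℓ} → Trichotomous _≡_ _≺_ →
                           ∀ {u v} → ¬ Ancestor G X v u →
                           Lex-< _≡_ _≺_ (path u) (path v) ⊎ Lex-< _≡_ (flip _≺_) (path u) (path v)
  ¬ancestor⇒path-ordered compare {u} {v} v⋠u =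
    Lex-<-dichotomy compare (path u) (path v) (v⋠u ∘ prefix⇒ancestor v (reach u))

  module PathOrder {ℓ} {_≺_ : Rel (Fin m) ℓ} (≺-sto : IsStrictTotalOrder _≡_ _≺_) where
    open IsStrictTotalOrder ≺-sto using (irrefl)
      renaming (_<?_ to _≺?_; trans to ≺-trans; <-resp-≈ to ≺-resp-≡)

    _⊏_ : Rel (Fin n) ℓ
    u ⊏ v = Lex-< _≡_ _≺_ (path u) (path v)

    _⊏?_ : Decidable₂ _⊏_
    u ⊏? v = <-decidable _≟_ _≺?_ (path u) (path v)

    ⊏-trans : Transitive _⊏_
    ⊏-trans = <-transitive isEquivalence ≺-resp-≡ ≺-trans

    ⊏-irrefl : ∀ {v} → ¬ v ⊏ v
    ⊏-irrefl = <-irreflexive irrefl (Pointwise.refl refl)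

    open Rank ⊏-trans ⊏-irrefl _⊏?_ public

    rank-increasing : ∀ {e} → e ∈ X → rank (src e) < rank (tgt e)
    rank-increasing {e} e∈X =
      rank-mono (subst (Lex-< _≡_ _≺_ (path (src e))) (sym (path-∷ʳ e∈X)) (Lex-<-∷ʳ (path (src e))))

  module Exchange
    (ρ : Fin n → ℕ) (ρ-increasing : ∀ {e} → e ∈ X → ρ (src e) < ρ (tgt e))
    (K : Subset n) (ê : Fin n → Fin m)
    (K-nonRoot : ∀ {v} → v ∈ K → v ≢ root)
    (ê-tgt : ∀ {v} → v ∈ K → tgt (ê v) ≡ v)
    (ê∉X : ∀ {v} → v ∈ K → ê v ∉ X)
    (ê-ρ : ∀ {v} → v ∈ K → ρ (src (ê v)) < ρ v)
    where

    Exchanged : Subset n → Fin m → Set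
    Exchanged J e = (tgt e ∈ J × e ≡ ê (tgt e)) ⊎ (tgt e ∉ J × e ∈ X)

    exchanged? : ∀ J e → Dec (Exchanged J e)
    exchanged? J e = (tgt e ∈? J ×-dec e ≟ ê (tgt e)) ⊎-dec (¬? (tgt e ∈? J) ×-dec e ∈? X)

    exchange : Subset n → Subset m
    exchange J = ⟦ exchanged? J ⟧

    ê∈exchange : ∀ {J v} → J ⊆ K → v ∈ J → ê v ∈ exchange J
    ê∈exchange {J} J⊆K v∈J =
      ∈⟦⟧⁺ (exchanged? J) (inj₁ (subst (_∈ J) (sym tgt≡) v∈J , cong ê (sym tgt≡)))
      where tgt≡ = ê-tgt (J⊆K v∈J)

    module _ {J : Subset n} (J⊆K : J ⊆ K) where

      inDegree-exchange : ∀ v → inDegree G (exchange J) v ≡ inDegree G X v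
      inDegree-exchange v with v ∈? J
      ... | yes v∈J = begin
        inDegree G (exchange J) v  ≡⟨ count-cong (inEdge? G (exchange J) v) (_≟ ê v) only-ê ê-in ⟩
        count (_≟ ê v)             ≡⟨ count-≡ (ê v) ⟩
        1                          ≡⟨ inDegree-nonRoot (K-nonRoot (J⊆K v∈J)) ⟨
        inDegree G X v             ∎
        where
        open ≡-Reasoning
        only-ê : ∀ {e} → InEdge G (exchange J) v e → e ≡ ê v
        only-ê (e∈ , refl) with ∈⟦⟧⁻ (exchanged? J) e∈
        ... | inj₁ (_ , e≡ê)  = e≡ê
        ... | inj₂ (v∉J , _) = contradiction v∈J v∉J
        ê-in : ∀ {e} → e ≡ ê v → InEdge G (exchange J) v e
        ê-in refl = ê∈exchange J⊆K v∈J , ê-tgt (J⊆K v∈J)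
      ... | no v∉J = count-cong (inEdge? G (exchange J) v) (inEdge? G X v) from-X to-X
        where
        from-X : ∀ {e} → InEdge G (exchange J) v e → InEdge G X v e
        from-X (e∈ , refl) with ∈⟦⟧⁻ (exchanged? J) e∈
        ... | inj₁ (v∈J , _) = contradiction v∈J v∉J
        ... | inj₂ (_ , e∈X) = e∈X , refl
        to-X : ∀ {e} → InEdge G X v e → InEdge G (exchange J) v e
        to-X (e∈X , refl) = ∈⟦⟧⁺ (exchanged? J) (inj₂ (v∉J , e∈X)) , refl

      exchange-arborescence : IsArborescence G (exchange J)
      exchange-arborescence = size , descent⇒reachable G ρ descent
        where
        size : ∣ exchange J ∣ ≡ n ∸ 1
        size = begin
          ∣ exchange J ∣                        ≡⟨ ∣S∣≡∑inDegree G (exchange J) ⟩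
          ∑[ v < n ] inDegree G (exchange J) v  ≡⟨ sum-cong-≗ inDegree-exchange ⟩
          ∑[ v < n ] inDegree G X v             ≡⟨ ∣S∣≡∑inDegree G X ⟨
          ∣ X ∣                                 ≡⟨ proj₁ X-arb ⟩
          n ∸ 1                                 ∎
          where open ≡-Reasoning
        descent : ∀ {v} → v ≢ root → ∃[ e ] (InEdge G (exchange J) v e × ρ (src e) < ρ v)
        descent {v} v≢root with v ∈? J
        ... | yes v∈J = ê v , (ê∈exchange J⊆K v∈J , ê-tgt (J⊆K v∈J)) , ê-ρ (J⊆K v∈J)
        ... | no v∉J with in-edge G (reach v) v≢root
        ...   | e , e∈X , refl =
          e , (∈⟦⟧⁺ (exchanged? J) (inj₂ (v∉J , e∈X)) , refl) , ρ-increasing e∈X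

    exchange-injective : ∀ {J J′} → J ⊆ K → J′ ⊆ K → exchange J ≡ exchange J′ → J ≡ J′
    exchange-injective J⊆K J′⊆K eq = ⊆-antisym (⊆-of J⊆K eq) (⊆-of J′⊆K (sym eq))
      where
      ⊆-of : ∀ {J J′} → J ⊆ K → exchange J ≡ exchange J′ → J ⊆ J′
      ⊆-of {J} {J′} J⊆K eq {v} v∈J
        with ∈⟦⟧⁻ (exchanged? J′) (subst (ê v ∈_) eq (ê∈exchange J⊆K v∈J))
      ... | inj₁ (tgt∈J′ , _) = subst (_∈ J′) (ê-tgt (J⊆K v∈J)) tgt∈J′
      ... | inj₂ (_ , ê∈X)    = contradiction ê∈X (ê∉X (J⊆K v∈J))

    2^∣K∣<arborescences : ∀ {k} → FewerArborescencesThan G k → 2 ^ ∣ K ∣ < k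
    2^∣K∣<arborescences {k} few = subst (_< k) length≡ (few exchanges unique all-arborescences)
      where
      exchanges = map exchange (subsetsOf K)
      length≡ = trans (length-map exchange (subsetsOf K)) (length-subsetsOf K)
      unique = Unique-map⁺-on exchange exchange-injective (subsetsOf-⊆ K) (subsetsOf-unique K)
      all-arborescences = All.map⁺ (All.map exchange-arborescence (subsetsOf-⊆ K))

module _ (G : RootedGraph) where
  open RootedGraph G

  Parallel : Fin m → Fin m → Set
  Parallel e e′ = src e ≡ src e′ × tgt e ≡ tgt e′

  -- In a flat graph an edge is determined by its ends and by whether it has an earlier copy.
  flat⇒m≤n*n*2 : Flat G → m ≤ n * n * 2
  flat⇒m≤n*n*2 flat = injective⇒≤ code-injective
    where
    HasEarlierCopy : Fin m → Set
    HasEarlierCopy e = ∃[ e₀ ] (e₀ <ᶠ e × Parallel e₀ e)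

    earlier? : ∀ e → Dec (HasEarlierCopy e)
    earlier? e = any? (λ e₀ → e₀ <ᶠ? e ×-dec (src e₀ ≟ src e ×-dec tgt e₀ ≟ tgt e))

    copy-index : Fin m → Fin 2
    copy-index e = if does (earlier? e) then suc zero else zero

    code : Fin m → Fin (n * n * 2)
    code e = combine (combine (src e) (tgt e)) (copy-index e)

    no-third-copy : ∀ {e e′} → e <ᶠ e′ → Parallel e e′ → copy-index e ≢ copy-index e′
    no-third-copy {e} {e′} e<e′ (src≡ , tgt≡) index≡ with earlier? e | earlier? e′
    ... | yes (e₀ , e₀<e , src₀≡ , tgt₀≡) | _ =
      flat e₀ e e′ (<⇒≢ e₀<e) (<⇒≢ (<ᶠ-trans e₀<e e<e′)) (<⇒≢ e<e′)
           src₀≡ tgt₀≡ (trans src₀≡ src≡) (trans tgt₀≡ tgt≡)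
    ... | no _ | yes _  = contradiction index≡ λ ()
    ... | no _ | no ¬e′ = contradiction (e , e<e′ , src≡ , tgt≡) ¬e′

    code-injective : ∀ {e e′} → code e ≡ code e′ → e ≡ e′
    code-injective {e} {e′} code≡
      with combine-injective (combine (src e) (tgt e)) (copy-index e) _ _ code≡
    ... | ends≡ , index≡ with combine-injective (src e) (tgt e) (src e′) (tgt e′) ends≡
    ...   | src≡ , tgt≡ with <-cmp e e′
    ...     | tri< e<e′ _ _ = contradiction index≡ (no-third-copy e<e′ (src≡ , tgt≡))
    ...     | tri≈ _ e≡e′ _ = e≡e′
    ...     | tri> _ _ e′<e = contradiction (sym index≡) (no-third-copy e′<e (sym src≡ , sym tgt≡))

n<2^[⌊log₂n⌋+1] : ∀ n → n < 2 ^ (⌊log₂ n ⌋ + 1)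
n<2^[⌊log₂n⌋+1] n = ≰⇒> λ 2^[⌊log₂n⌋+1]≤n →
  m+1+n≰m ⌊log₂ n ⌋
    (subst (_≤ ⌊log₂ n ⌋) (⌊log₂[2^n]⌋≡n (⌊log₂ n ⌋ + 1)) (⌊log₂⌋-mono-≤ 2^[⌊log₂n⌋+1]≤n))

2^k<m^4⇒k≤12[⌊log₂n⌋+1] : ∀ n {m k} → m ≤ n * n * 2 → 2 ^ k < m ^ 4 → k ≤ 12 * (⌊log₂ n ⌋ + 1)
2^k<m^4⇒k≤12[⌊log₂n⌋+1] n {m} {k} m≤n*n*2 2^k<m^4 = <⇒≤ (<-≤-trans k<e (e≤12a ⌊log₂ n ⌋))
  where
  a = ⌊log₂ n ⌋ + 1
  e = (a + a + 1) * 4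
  m^4≤2^e : m ^ 4 ≤ 2 ^ e
  m^4≤2^e = begin
    m ^ 4                    ≤⟨ ^-monoˡ-≤ 4 (≤-trans m≤n*n*2 (*-monoˡ-≤ 2 (*-mono-≤ n≤2^a n≤2^a))) ⟩
    (2 ^ a * 2 ^ a * 2) ^ 4  ≡⟨ cong (λ x → (x * 2) ^ 4) (^-distribˡ-+-* 2 a a) ⟨
    (2 ^ (a + a) * 2) ^ 4    ≡⟨ cong (_^ 4) (^-distribˡ-+-* 2 (a + a) 1) ⟨
    (2 ^ (a + a + 1)) ^ 4    ≡⟨ ^-*-assoc 2 (a + a + 1) 4 ⟩
    2 ^ e                    ∎
    where
    open ≤-Reasoning
    n≤2^a = <⇒≤ (n<2^[⌊log₂n⌋+1] n)
  k<e : k < e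
  k<e = ≰⇒> λ e≤k → <⇒≱ 2^k<m^4 (≤-trans m^4≤2^e (^-monoʳ-≤ 2 e≤k))
  e≤12a : ∀ L → (L + 1 + (L + 1) + 1) * 4 ≤ 12 * (L + 1)
  e≤12a L = subst ((L + 1 + (L + 1) + 1) * 4 ≤_) (expand L) (m≤m+n _ (4 * L))
    where
    expand : ∀ L → (L + 1 + (L + 1) + 1) * 4 + 4 * L ≡ 12 * (L + 1)
    expand = solve-∀

module HeadsOfC
  (G : RootedGraph) (flat : Flat G) (few : FewerArborescencesThan G (RootedGraph.m G ^ 4))
  {A B : Subset (RootedGraph.m G)} (A-arb : IsArborescence G A) (B-arb : IsArborescence G B)
  (ancestor-condition : AncestorCondition G A B)
  {T : Subset (RootedGraph.n G)} (heads : ∀ v → v ∈ T → HeadOfC G A B v)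
  where
  open RootedGraph G

  -- m ≢ 0, as the empty list of arborescences is shorter than m ^ 4.
  some-edge : Fin m
  some-edge = fin-of-0<^4 m (few [] [] [])
    where
    fin-of-0<^4 : ∀ k → 0 < k ^ 4 → Fin k
    fin-of-0<^4 (suc k) _ = zero

  ê : Fin n → Fin m
  ê v with v ∈? T
  ... | yes v∈T = proj₁ (heads v v∈T)
  ... | no _    = some-edge

  ê-spec : ∀ {v} → v ∈ T → ê v ∉ A × ê v ∉ B × tgt (ê v) ≡ v
  ê-spec {v} v∈T with v ∈? T
  ... | yes v∈T′ = proj₂ (heads v v∈T′)
  ... | no v∉T   = contradiction v∈T v∉T

  ê-tgt : ∀ {v} → v ∈ T → tgt (ê v) ≡ v
  ê-tgt = proj₂ ∘ proj₂ ∘ ê-spec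

  T-nonRoot : ∀ {v} → v ∈ T → v ≢ root
  T-nonRoot {v} v∈T refl with ancestor-condition (ê v)
  ... | inj₁ ¬A = ¬A (subst (λ w → Ancestor G A w (src (ê v))) (sym (ê-tgt v∈T)) (proj₂ A-arb _))
  ... | inj₂ ¬B = ¬B (subst (λ w → Ancestor G B w (src (ê v))) (sym (ê-tgt v∈T)) (proj₂ B-arb _))

  module InTree {X} (X-arb : IsArborescence G X) (ê∉X : ∀ {v} → v ∈ T → ê v ∉ X) where
    open Arborescence G X-arb

    module ByOrder {ℓ} {_≺_ : Rel (Fin m) ℓ} (≺-sto : IsStrictTotalOrder _≡_ _≺_) where
      open PathOrder ≺-sto

      Ascending : Fin n → Set
      Ascending v = v ∈ T × rank (src (ê v)) < rank v

      ascending? : Decidable Ascending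
      ascending? v = v ∈? T ×-dec rank (src (ê v)) <? rank v

      K : Subset n
      K = ⟦ ascending? ⟧

      ∈K⁺ : ∀ {v} → v ∈ T → src (ê v) ⊏ v → v ∈ K
      ∈K⁺ v∈T ⊏v = ∈⟦⟧⁺ ascending? (v∈T , rank-mono ⊏v)

      ∣K∣≤ : ∣ K ∣ ≤ 12 * (⌊log₂ n ⌋ + 1)
      ∣K∣≤ = 2^k<m^4⇒k≤12[⌊log₂n⌋+1] n (flat⇒m≤n*n*2 G flat) (2^∣K∣<arborescences few)
        where
        in-T : ∀ {v} → v ∈ K → v ∈ T
        in-T = proj₁ ∘ ∈⟦⟧⁻ ascending?
        ascends : ∀ {v} → v ∈ K → rank (src (ê v)) < rank v
        ascends = proj₂ ∘ ∈⟦⟧⁻ ascending?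
        open Exchange rank rank-increasing K ê
                      (T-nonRoot ∘ in-T) (ê-tgt ∘ in-T) (ê∉X ∘ in-T) ascends

    module Fwd = ByOrder <-isStrictTotalOrder
    module Bwd = ByOrder (Flip.isStrictTotalOrder <-isStrictTotalOrder)

    K : Subset n
    K = Fwd.K ∪ Bwd.K

    ∈K⁺ : ∀ {v} → v ∈ T → ¬ Ancestor G X (tgt (ê v)) (src (ê v)) → v ∈ K
    ∈K⁺ {v} v∈T ¬anc =
      x∈p∪q⁺ (Sum.map (Fwd.∈K⁺ v∈T) (Bwd.∈K⁺ v∈T) (¬ancestor⇒path-ordered <-cmp ¬anc′))
      where
      ¬anc′ : ¬ Ancestor G X v (src (ê v))
      ¬anc′ = ¬anc ∘ subst (λ w → Ancestor G X w (src (ê v))) (sym (ê-tgt v∈T))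

    ∣K∣≤ : ∣ K ∣ ≤ 24 * (⌊log₂ n ⌋ + 1)
    ∣K∣≤ = begin
      ∣ Fwd.K ∪ Bwd.K ∣                            ≤⟨ ∣p∪q∣≤∣p∣+∣q∣ Fwd.K Bwd.K ⟩
      ∣ Fwd.K ∣ + ∣ Bwd.K ∣                        ≤⟨ +-mono-≤ Fwd.∣K∣≤ Bwd.∣K∣≤ ⟩
      12 * (⌊log₂ n ⌋ + 1) + 12 * (⌊log₂ n ⌋ + 1)  ≡⟨ *-distribʳ-+ (⌊log₂ n ⌋ + 1) 12 12 ⟨
      24 * (⌊log₂ n ⌋ + 1)                         ∎
      where open ≤-Reasoning

  module InA = InTree A-arb (proj₁ ∘ ê-spec)
  module InB = InTree B-arb (proj₁ ∘ proj₂ ∘ ê-spec)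

  T⊆K : T ⊆ InA.K ∪ InB.K
  T⊆K {v} v∈T = x∈p∪q⁺ (Sum.map (InA.∈K⁺ v∈T) (InB.∈K⁺ v∈T) (ancestor-condition (ê v)))

  ∣T∣≤48[⌊log₂n⌋+1] : ∣ T ∣ ≤ 48 * (⌊log₂ n ⌋ + 1)
  ∣T∣≤48[⌊log₂n⌋+1] = begin
    ∣ T ∣                                        ≤⟨ p⊆q⇒∣p∣≤∣q∣ T⊆K ⟩
    ∣ InA.K ∪ InB.K ∣                            ≤⟨ ∣p∪q∣≤∣p∣+∣q∣ InA.K InB.K ⟩
    ∣ InA.K ∣ + ∣ InB.K ∣                        ≤⟨ +-mono-≤ InA.∣K∣≤ InB.∣K∣≤ ⟩
    24 * (⌊log₂ n ⌋ + 1) + 24 * (⌊log₂ n ⌋ + 1)  ≡⟨ *-distribʳ-+ (⌊log₂ n ⌋ + 1) 24 24 ⟨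
    48 * (⌊log₂ n ⌋ + 1)                         ∎
    where open ≤-Reasoning

open RootedGraph

lemma12 : ∃[ c ] ∀ (G : RootedGraph) → Trimmed G → Flat G →
    FewerArborescencesThan G (m G ^ 4) →
    ∀ (A B : Subset (m G)) → IsArborescence G A → IsArborescence G B →
    EdgeDisjoint G A B → AncestorCondition G A B →
    ∀ (T : Subset (n G)) → (∀ v → v ∈ T → HeadOfC G A B v) →
    ∣ T ∣ ≤ c * (⌊log₂ n G ⌋ + 1)
lemma12 = 48 , λ G _ flat few A B A-arb B-arb _ ancestor-condition T heads →
  HeadsOfC.∣T∣≤48[⌊log₂n⌋+1] G flat few A-arb B-arb ancestor-condition heads
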